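{- We have the inclusion $$\overline{A\sqcup\!\sqcup B}\subset\overline A\sqcup\!\sqcup\overline B$$ for the shuffle product $A\sqcup\!\sqcup B$ of $A,B\in\mathbb K\langle\!\langle X_1,\dots,X_k\rangle\!\rangle$.
   Context: $\mathbb K\langle\!\langle X_1,\dots,X_k\rangle\!\rangle$ denotes formal power series $A=\sum_{\mathbf X\in\mathcal X^*}(A,\mathbf X)\mathbf X$ in non-commuting variables, $\mathcal X^*$ the free monoid on $\mathcal X=\{X_1,\dots,X_k\}$. The shuffle product of monomials is defined recursively by $\mathbf X\sqcup\!\sqcup1=1\sqcup\!\sqcup\mathbf X=\mathbf X$ and $(\mathbf XX_s)\sqcup\!\sqcup(\mathbf X'X_t)=(\mathbf X\sqcup\!\sqcup(\mathbf X'X_t))X_s+((\mathbf XX_s)\sqcup\!\sqcup\mathbf X')X_t$, extended bilinearly. For a monomial $\mathbf T$, $\rho(\mathbf T)A=\sum_{\mathbf X}(A,\mathbf X\mathbf T)\mathbf X$; the recursive closure $\overline A$ is the vector space spanned by $\{\rho(\mathbf T)A:\mathbf T\in\mathcal X^*\}$. For subspaces $\mathcal A,\mathcal B$, $\mathcal A\sqcup\!\sqcup\mathcal B$ is the span of all $a\sqcup\!\sqcup b$ with $a\in\mathcal A$, $b\in\mathcal B$. -}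

module Defs where

open import Level using (Level; _⊔_) renaming (suc to lsuc)
open import Algebra.Bundles using (CommutativeRing)
open import Data.Nat using (ℕ; zero; suc)
open import Data.Fin using (Fin)
open import Data.Fin.Properties using () renaming (_≟_ to _≟F_)
open import Data.List using (List; []; _∷_; map; _++_; concatMap; length; allFin; foldr)
open import Data.List.Properties using (≡-dec)
open import Data.Product using (Σ; ∃; _×_; _,_)
open import Relation.Nullary using (¬_; yes; no)
open import Relation.Binary.PropositionalEquality using (_≡_)

record Field (c ℓ : Level) : Set (lsuc (c ⊔ ℓ)) where
  field
    commutativeRing : CommutativeRing c ℓ
  open CommutativeRing commutativeRing public
  field
    0≉1     : ¬ (0# ≈ 1#)
    inverse : ∀ x → ¬ (x ≈ 0#) → ∃ λ y → (x * y) ≈ 1#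

-- CONVENTION: a word is stored REVERSED, i.e. the head of the list is the
-- LAST letter.  So the word  X X_s  (X followed by the letter X_s) is  s ∷ X,
-- and the concatenation  X T  of words is  T ++ X.
Word : ℕ → Set
Word k = List (Fin k)

_·_ : ∀ {k} → Word k → Word k → Word k
X · T = T ++ X

ε : ∀ {k} → Word k
ε = []

-- Shuffle product of monomials, as a list (multiset) of words, following
--   X ⧢ 1 = 1 ⧢ X = X,
--   (X X_s) ⧢ (X' X_t) = (X ⧢ (X' X_t)) X_s + ((X X_s) ⧢ X') X_t.
_⧢w_ : ∀ {k} → Word k → Word k → List (Word k)
[]      ⧢w v       = v ∷ []
(s ∷ X) ⧢w []      = (s ∷ X) ∷ []
(s ∷ X) ⧢w (t ∷ Y) = map (s ∷_) (X ⧢w (t ∷ Y)) ++ map (t ∷_) ((s ∷ X) ⧢w Y)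

wordsOfLength : ∀ {k} → ℕ → List (Word k)
wordsOfLength zero    = [] ∷ []
wordsOfLength {k} (suc n) = concatMap (λ s → map (s ∷_) (wordsOfLength n)) (allFin k)

wordsUpTo : ∀ {k} → ℕ → List (Word k)
wordsUpTo zero    = wordsOfLength zero
wordsUpTo (suc n) = wordsOfLength (suc n) ++ wordsUpTo n

module Series {c ℓ : Level} (K : Field c ℓ) (k : ℕ) where
  open Field K

  PowerSeries : Set c
  PowerSeries = Word k → Carrier

  _≈ₛ_ : PowerSeries → PowerSeries → Set ℓ
  A ≈ₛ B = ∀ X → A X ≈ B X

  Σ-list : ∀ {a} {I : Set a} → List I → (I → Carrier) → Carrier
  Σ-list xs f = foldr (λ i r → f i + r) 0# xs

  ℕ→K : ℕ → Carrier
  ℕ→K zero    = 0#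
  ℕ→K (suc n) = 1# + ℕ→K n

  count : List (Word k) → Word k → Carrier
  count [] w = 0#
  count (u ∷ ws) w with ≡-dec _≟F_ u w
  ... | yes _ = 1# + count ws w
  ... | no  _ = count ws w

  -- shuffle product of series: bilinear (coefficientwise finite) extension
  --   (A ⧢ B , W) = Σ_{U,V} (A,U)(B,V) (U ⧢ V , W);
  -- only words U, V of length ≤ |W| can contribute.
  _⧢_ : PowerSeries → PowerSeries → PowerSeries
  (A ⧢ B) W = Σ-list (wordsUpTo (length W)) λ U →
              Σ-list (wordsUpTo (length W)) λ V →
              (A U * B V) * count (U ⧢w V) W

  ρ : Word k → PowerSeries → PowerSeries
  ρ T A X = A (X · T)

  InSpan : ∀ {a} {I : Set a} → (I → PowerSeries) → PowerSeries → Set _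
  InSpan {I = I} f C = Σ (List (Carrier × I)) λ cs →
    C ≈ₛ (λ X → Σ-list cs (λ { (c , i) → c * f i X }))

  InClosure : PowerSeries → PowerSeries → Set _
  InClosure A = InSpan (λ T → ρ T A)

  InShuffleSpace : ∀ {p q} → (PowerSeries → Set p) → (PowerSeries → Set q)
                   → PowerSeries → Set _
  InShuffleSpace 𝒜 ℬ =
    InSpan {I = Σ (PowerSeries × PowerSeries) λ { (a , b) → 𝒜 a × ℬ b }}
           (λ { ((a , b) , _) → a ⧢ b })

module Submission where

-- The proof rests on the Leibniz rule for the shuffle product,
--   ρ(X_r)(A ⧢ B) = ρ(X_r)A ⧢ B + A ⧢ ρ(X_r)B ,
-- read off coefficientwise from the recursion of the shuffle of words.
-- Iterating it along a word T gives the splitting formula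
--   ρ(T)(A ⧢ B) = Σ_{(T₁,T₂)} ρ(T₁)A ⧢ ρ(T₂)B ,
-- the sum running over the ways to distribute the letters of T between
-- the two factors.  Hence every generator ρ(T)(A ⧢ B) of the closure lies
-- in \overline{A} ⧢ \overline{B}, and so does their span.

open import Defs
open import Level using (Level)
open import Data.Nat using (ℕ; zero; suc; _≤_; s≤s)
open import Data.Nat.Properties using (m≤n⇒m≤1+n; ≤-refl)
open import Data.Fin using (Fin; zero; suc)
open import Data.Fin.Properties using (suc-injective) renaming (_≟_ to _≟F_)
open import Data.List using (List; []; _∷_; map; _++_; concatMap; length; allFin)
open import Data.List.Properties using (≡-dec; map-tabulate; ∷-injective)
open import Data.Product using (_×_; _,_; proj₁; proj₂; map₁; map₂; uncurry)
open import Relation.Nullary using (¬_; Dec; yes; no; contradiction)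
open import Relation.Nullary.Decidable using (_×-dec_)
open import Relation.Binary.PropositionalEquality as P using (_≡_)
open import Function using (id; _∘_)
import Algebra.Properties.CommutativeSemigroup as CommutativeSemigroupProperties

module ShuffleClosure {c ℓ : Level} (K : Field c ℓ) (k : ℕ) where
  open Field K hiding (zero)
  open Series K k
  open import Relation.Binary.Reasoning.Setoid setoid
  open CommutativeSemigroupProperties +-commutativeSemigroup
    using () renaming (interchange to +-interchange; x∙yz≈y∙xz to +-exchange)
  open CommutativeSemigroupProperties *-commutativeSemigroup
    using () renaming (x∙yz≈y∙xz to *-exchange)

  module _ {a} {I : Set a} where

    Σ-cong : ∀ (xs : List I) {f g : I → Carrier} →
             (∀ i → f i ≈ g i) → Σ-list xs f ≈ Σ-list xs g
    Σ-cong []       f≈g = refl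
    Σ-cong (x ∷ xs) f≈g = +-cong (f≈g x) (Σ-cong xs f≈g)

    Σ-zero : ∀ (xs : List I) {f : I → Carrier} → (∀ i → f i ≈ 0#) → Σ-list xs f ≈ 0#
    Σ-zero []       f≈0 = refl
    Σ-zero (x ∷ xs) f≈0 = trans (+-cong (f≈0 x) (Σ-zero xs f≈0)) (+-identityˡ 0#)

    Σ-+ : ∀ (xs : List I) (f g : I → Carrier) →
          Σ-list xs (λ i → f i + g i) ≈ Σ-list xs f + Σ-list xs g
    Σ-+ []       f g = sym (+-identityˡ 0#)
    Σ-+ (x ∷ xs) f g =
      trans (+-cong refl (Σ-+ xs f g)) (+-interchange (f x) (g x) (Σ-list xs f) (Σ-list xs g))

    Σ-*ˡ : ∀ (xs : List I) (α : Carrier) (f : I → Carrier) →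
           Σ-list xs (λ i → α * f i) ≈ α * Σ-list xs f
    Σ-*ˡ []       α f = sym (zeroʳ α)
    Σ-*ˡ (x ∷ xs) α f = trans (+-cong refl (Σ-*ˡ xs α f)) (sym (distribˡ α (f x) (Σ-list xs f)))

    Σ-++ : ∀ (xs ys : List I) (f : I → Carrier) →
           Σ-list (xs ++ ys) f ≈ Σ-list xs f + Σ-list ys f
    Σ-++ []       ys f = sym (+-identityˡ _)
    Σ-++ (x ∷ xs) ys f = trans (+-cong refl (Σ-++ xs ys f)) (sym (+-assoc _ _ _))

    Σ-map : ∀ {b} {J : Set b} (g : J → I) (xs : List J) (f : I → Carrier) →
            Σ-list (map g xs) f ≡ Σ-list xs (f ∘ g)
    Σ-map g []       f = P.refl
    Σ-map g (x ∷ xs) f = P.cong (f (g x) +_) (Σ-map g xs f)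

    Σ-concatMap : ∀ {b} {J : Set b} (h : J → List I) (xs : List J) (f : I → Carrier) →
                  Σ-list (concatMap h xs) f ≈ Σ-list xs (λ x → Σ-list (h x) f)
    Σ-concatMap h []       f = refl
    Σ-concatMap h (x ∷ xs) f =
      trans (Σ-++ (h x) (concatMap h xs) f) (+-cong refl (Σ-concatMap h xs f))

  Σ-swap : ∀ {a b} {I : Set a} {J : Set b} (xs : List I) (ys : List J) (f : I → J → Carrier) →
           Σ-list xs (λ x → Σ-list ys (f x)) ≈ Σ-list ys (λ y → Σ-list xs (λ x → f x y))
  Σ-swap []       ys f = sym (Σ-zero ys (λ _ → refl))
  Σ-swap (x ∷ xs) ys f =
    trans (+-cong refl (Σ-swap xs ys f)) (sym (Σ-+ ys (f x) (λ y → Σ-list xs (λ x → f x y))))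

  δ : ∀ {p} {Q : Set p} → Dec Q → Carrier
  δ (yes _) = 1#
  δ (no _)  = 0#

  δ-yes : ∀ {p} {Q : Set p} → Q → (d : Dec Q) → δ d ≈ 1#
  δ-yes q (yes _) = refl
  δ-yes q (no ¬q) = contradiction q ¬q

  δ-no : ∀ {p} {Q : Set p} → ¬ Q → (d : Dec Q) → δ d ≈ 0#
  δ-no ¬q (yes q) = contradiction q ¬q
  δ-no ¬q (no _)  = refl

  δ-cong : ∀ {p q} {Q : Set p} {R : Set q} → (Q → R) → (R → Q) →
           (d : Dec Q) (e : Dec R) → δ d ≈ δ e
  δ-cong Q⇒R R⇒Q (yes q) e = sym (δ-yes (Q⇒R q) e)
  δ-cong Q⇒R R⇒Q (no ¬q) e = sym (δ-no (¬q ∘ R⇒Q) e)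

  δ-× : ∀ {p q} {Q : Set p} {R : Set q} (d : Dec Q) (e : Dec R) → δ (d ×-dec e) ≈ δ d * δ e
  δ-× (yes q) e = trans (δ-cong proj₂ (q ,_) (yes q ×-dec e) e) (sym (*-identityˡ (δ e)))
  δ-× (no ¬q) e = trans (δ-no (¬q ∘ proj₁) (no ¬q ×-dec e)) (sym (zeroˡ (δ e)))

  _≟w_ : (U W : Word k) → Dec (U ≡ W)
  _≟w_ = ≡-dec _≟F_

  δ-word-∷ : ∀ s U r W → δ ((s ∷ U) ≟w (r ∷ W)) ≈ δ (s ≟F r) * δ (U ≟w W)
  δ-word-∷ s U r W =
    trans (δ-cong ∷-injective (uncurry (P.cong₂ _∷_)) ((s ∷ U) ≟w (r ∷ W)) ((s ≟F r) ×-dec (U ≟w W)))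
          (δ-× (s ≟F r) (U ≟w W))

  Σ-allFin-suc : ∀ {n} (h : Fin (suc n) → Carrier) →
                 Σ-list (allFin (suc n)) h ≡ h zero + Σ-list (allFin n) (h ∘ suc)
  Σ-allFin-suc {n} h = P.cong (h zero +_)
    (P.trans (P.cong (λ xs → Σ-list xs h) (P.sym (map-tabulate id suc))) (Σ-map suc (allFin n) h))

  δ-sift : ∀ {n} (r : Fin n) (h : Fin n → Carrier) →
           Σ-list (allFin n) (λ s → δ (s ≟F r) * h s) ≈ h r
  δ-sift {suc n} zero h = begin
      Σ-list (allFin (suc n)) (λ s → δ (s ≟F zero) * h s)
    ≡⟨ Σ-allFin-suc (λ s → δ (s ≟F zero) * h s) ⟩
      δ (zero {n} ≟F zero) * h zero + Σ-list (allFin n) (λ s → δ (suc s ≟F zero) * h (suc s))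
    ≈⟨ +-cong (*-identityˡ (h zero))
              (Σ-zero (allFin n) (λ s → trans (*-cong (δ-no (λ ()) (suc s ≟F zero)) refl) (zeroˡ _))) ⟩
      h zero + 0#
    ≈⟨ +-identityʳ (h zero) ⟩
      h zero
    ∎
  δ-sift {suc n} (suc r) h = begin
      Σ-list (allFin (suc n)) (λ s → δ (s ≟F suc r) * h s)
    ≡⟨ Σ-allFin-suc (λ s → δ (s ≟F suc r) * h s) ⟩
      δ (zero ≟F suc r) * h zero + Σ-list (allFin n) (λ s → δ (suc s ≟F suc r) * h (suc s))
    ≈⟨ +-cong (zeroˡ (h zero))
              (Σ-cong (allFin n) (λ s →
                 *-cong (δ-cong suc-injective (P.cong suc) (suc s ≟F suc r) (s ≟F r)) refl)) ⟩
      0# + Σ-list (allFin n) (λ s → δ (s ≟F r) * h (suc s))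
    ≈⟨ +-identityˡ _ ⟩
      Σ-list (allFin n) (λ s → δ (s ≟F r) * h (suc s))
    ≈⟨ δ-sift r (h ∘ suc) ⟩
      h (suc r)
    ∎

  -- Sums over the words of length ≤ m, split by their first letter.
  -- (Words are stored reversed, so the list head is the letter that
  -- ρ(X_s) removes.)

  Σ-wordsOfLength-suc : ∀ m (f : Word k → Carrier) →
    Σ-list (wordsOfLength (suc m)) f ≈
    Σ-list (allFin k) (λ s → Σ-list (wordsOfLength m) (λ U → f (s ∷ U)))
  Σ-wordsOfLength-suc m f =
    trans (Σ-concatMap (λ s → map (s ∷_) (wordsOfLength m)) (allFin k) f)
          (Σ-cong (allFin k) (λ s → reflexive (Σ-map (s ∷_) (wordsOfLength m) f)))

  Σ-wordsUpTo-suc : ∀ m (f : Word k → Carrier) →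
    Σ-list (wordsUpTo (suc m)) f ≈
    f [] + Σ-list (allFin k) (λ s → Σ-list (wordsUpTo m) (λ U → f (s ∷ U)))
  Σ-wordsUpTo-suc zero f = begin
      Σ-list (wordsOfLength 1 ++ wordsUpTo 0) f
    ≈⟨ Σ-++ (wordsOfLength 1) (wordsUpTo 0) f ⟩
      Σ-list (wordsOfLength 1) f + (f [] + 0#)
    ≈⟨ +-cong (Σ-wordsOfLength-suc 0 f) (+-identityʳ (f [])) ⟩
      Σ-list (allFin k) (λ s → f (s ∷ []) + 0#) + f []
    ≈⟨ +-comm _ (f []) ⟩
      f [] + Σ-list (allFin k) (λ s → f (s ∷ []) + 0#)
    ∎
  Σ-wordsUpTo-suc (suc m) f = begin
      Σ-list (wordsOfLength (suc (suc m)) ++ wordsUpTo (suc m)) f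
    ≈⟨ Σ-++ (wordsOfLength (suc (suc m))) (wordsUpTo (suc m)) f ⟩
      Σ-list (wordsOfLength (suc (suc m))) f + Σ-list (wordsUpTo (suc m)) f
    ≈⟨ +-cong (Σ-wordsOfLength-suc (suc m) f) (Σ-wordsUpTo-suc m f) ⟩
      Σ-list (allFin k) (λ s → Σ-list (wordsOfLength (suc m)) (f ∘ (s ∷_)))
        + (f [] + Σ-list (allFin k) (λ s → Σ-list (wordsUpTo m) (f ∘ (s ∷_))))
    ≈⟨ +-exchange _ (f []) _ ⟩
      f [] + (Σ-list (allFin k) (λ s → Σ-list (wordsOfLength (suc m)) (f ∘ (s ∷_)))
                + Σ-list (allFin k) (λ s → Σ-list (wordsUpTo m) (f ∘ (s ∷_))))
    ≈⟨ +-cong refl (sym (Σ-+ (allFin k) _ _)) ⟩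
      f [] + Σ-list (allFin k) (λ s → Σ-list (wordsOfLength (suc m)) (f ∘ (s ∷_))
                                    + Σ-list (wordsUpTo m) (f ∘ (s ∷_)))
    ≈⟨ +-cong refl (Σ-cong (allFin k) (λ s →
         sym (Σ-++ (wordsOfLength (suc m)) (wordsUpTo m) (f ∘ (s ∷_))))) ⟩
      f [] + Σ-list (allFin k) (λ s → Σ-list (wordsUpTo (suc m)) (f ∘ (s ∷_)))
    ∎

  Σ-wordsUpTo-at-ε : ∀ m (f : Word k → Carrier) → (∀ s U → f (s ∷ U) ≈ 0#) →
                     Σ-list (wordsUpTo m) f ≈ f []
  Σ-wordsUpTo-at-ε zero    f f≈0 = +-identityʳ (f [])
  Σ-wordsUpTo-at-ε (suc m) f f≈0 =
    trans (Σ-wordsUpTo-suc m f)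
          (trans (+-cong refl (Σ-zero (allFin k) (λ s → Σ-zero (wordsUpTo m) (f≈0 s))))
                 (+-identityʳ (f [])))

  Σ-wordsUpTo-first-letter : ∀ m r (f : Word k → Carrier) (g : Fin k → Word k → Carrier) →
    f [] ≈ 0# → (∀ s U → f (s ∷ U) ≈ δ (s ≟F r) * g s U) →
    Σ-list (wordsUpTo (suc m)) f ≈ Σ-list (wordsUpTo m) (g r)
  Σ-wordsUpTo-first-letter m r f g f[]≈0 f∷≈ = begin
      Σ-list (wordsUpTo (suc m)) f
    ≈⟨ Σ-wordsUpTo-suc m f ⟩
      f [] + Σ-list (allFin k) (λ s → Σ-list (wordsUpTo m) (λ U → f (s ∷ U)))
    ≈⟨ +-cong f[]≈0 (Σ-cong (allFin k) (λ s → Σ-cong (wordsUpTo m) (f∷≈ s))) ⟩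
      0# + Σ-list (allFin k) (λ s → Σ-list (wordsUpTo m) (λ U → δ (s ≟F r) * g s U))
    ≈⟨ +-identityˡ _ ⟩
      Σ-list (allFin k) (λ s → Σ-list (wordsUpTo m) (λ U → δ (s ≟F r) * g s U))
    ≈⟨ Σ-swap (allFin k) (wordsUpTo m) _ ⟩
      Σ-list (wordsUpTo m) (λ U → Σ-list (allFin k) (λ s → δ (s ≟F r) * g s U))
    ≈⟨ Σ-cong (wordsUpTo m) (λ U → δ-sift r (λ s → g s U)) ⟩
      Σ-list (wordsUpTo m) (g r)
    ∎

  count-∷ : ∀ u ws w → count (u ∷ ws) w ≈ δ (u ≟w w) + count ws w
  count-∷ u ws w with u ≟w w
  ... | yes _ = refl
  ... | no _  = sym (+-identityˡ _)

  count-++ : ∀ xs ys w → count (xs ++ ys) w ≈ count xs w + count ys w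
  count-++ []       ys w = sym (+-identityˡ _)
  count-++ (x ∷ xs) ys w = begin
      count (x ∷ xs ++ ys) w
    ≈⟨ count-∷ x (xs ++ ys) w ⟩
      δ (x ≟w w) + count (xs ++ ys) w
    ≈⟨ +-cong refl (count-++ xs ys w) ⟩
      δ (x ≟w w) + (count xs w + count ys w)
    ≈⟨ sym (+-assoc _ _ _) ⟩
      (δ (x ≟w w) + count xs w) + count ys w
    ≈⟨ +-cong (sym (count-∷ x xs w)) refl ⟩
      count (x ∷ xs) w + count ys w
    ∎

  count-map-∷-ε : ∀ s ws → count (map (s ∷_) ws) [] ≈ 0#
  count-map-∷-ε s []       = refl
  count-map-∷-ε s (u ∷ ws) =
    trans (count-∷ (s ∷ u) (map (s ∷_) ws) [])
          (trans (+-cong (δ-no (λ ()) ((s ∷ u) ≟w [])) (count-map-∷-ε s ws)) (+-identityˡ 0#))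

  count-map-∷-∷ : ∀ s ws r W → count (map (s ∷_) ws) (r ∷ W) ≈ δ (s ≟F r) * count ws W
  count-map-∷-∷ s []       r W = sym (zeroʳ _)
  count-map-∷-∷ s (u ∷ ws) r W = begin
      count (map (s ∷_) (u ∷ ws)) (r ∷ W)
    ≈⟨ count-∷ (s ∷ u) (map (s ∷_) ws) (r ∷ W) ⟩
      δ ((s ∷ u) ≟w (r ∷ W)) + count (map (s ∷_) ws) (r ∷ W)
    ≈⟨ +-cong (δ-word-∷ s u r W) (count-map-∷-∷ s ws r W) ⟩
      δ (s ≟F r) * δ (u ≟w W) + δ (s ≟F r) * count ws W
    ≈⟨ sym (distribˡ _ _ _) ⟩
      δ (s ≟F r) * (δ (u ≟w W) + count ws W)
    ≈⟨ *-cong refl (sym (count-∷ u ws W)) ⟩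
      δ (s ≟F r) * count (u ∷ ws) W
    ∎

  ⧢w-identityʳ : ∀ (U : Word k) → U ⧢w [] ≡ U ∷ []
  ⧢w-identityʳ []      = P.refl
  ⧢w-identityʳ (s ∷ U) = P.refl

  count-⧢w-ε-left : ∀ s U V → count ((s ∷ U) ⧢w V) [] ≈ 0#
  count-⧢w-ε-left s U []      = count-map-∷-ε s (U ∷ [])
  count-⧢w-ε-left s U (t ∷ V) =
    trans (count-++ (map (s ∷_) (U ⧢w (t ∷ V))) (map (t ∷_) ((s ∷ U) ⧢w V)) [])
          (trans (+-cong (count-map-∷-ε s (U ⧢w (t ∷ V))) (count-map-∷-ε t ((s ∷ U) ⧢w V)))
                 (+-identityˡ 0#))

  count-⧢w-ε-right : ∀ t V → count ([] ⧢w (t ∷ V)) [] ≈ 0#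
  count-⧢w-ε-right t V = count-map-∷-ε t (V ∷ [])

  count-⧢w-ε-ε : count ([] ⧢w []) [] ≈ 1#
  count-⧢w-ε-ε = trans (count-∷ [] [] []) (trans (+-identityʳ _) (δ-yes P.refl ([] ≟w [])))

  -- The recursion  (U ⧢ V , X_r W) = [U = X_r U'] (U' ⧢ V , W) + [V = X_r V'] (U ⧢ V' , W),
  -- split into the contribution of the left and of the right factor.
  fromLeft : Fin k → Word k → Word k → Word k → Carrier
  fromLeft r []      V W = 0#
  fromLeft r (s ∷ U) V W = δ (s ≟F r) * count (U ⧢w V) W

  fromRight : Fin k → Word k → Word k → Word k → Carrier
  fromRight r U []      W = 0#
  fromRight r U (t ∷ V) W = δ (t ≟F r) * count (U ⧢w V) W

  count-⧢w-∷ : ∀ U V r W → count (U ⧢w V) (r ∷ W) ≈ fromLeft r U V W + fromRight r U V W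
  count-⧢w-∷ []      []      r W =
    trans (count-∷ [] [] (r ∷ W)) (+-cong (δ-no (λ ()) ([] ≟w (r ∷ W))) refl)
  count-⧢w-∷ []      (t ∷ V) r W =
    trans (count-map-∷-∷ t (V ∷ []) r W) (sym (+-identityˡ _))
  count-⧢w-∷ (s ∷ U) []      r W =
    trans (count-map-∷-∷ s (U ∷ []) r W)
          (trans (*-cong refl (reflexive (P.cong (λ ws → count ws W) (P.sym (⧢w-identityʳ U)))))
                 (sym (+-identityʳ _)))
  count-⧢w-∷ (s ∷ U) (t ∷ V) r W =
    trans (count-++ (map (s ∷_) (U ⧢w (t ∷ V))) (map (t ∷_) ((s ∷ U) ⧢w V)) (r ∷ W))
          (+-cong (count-map-∷-∷ s (U ⧢w (t ∷ V)) r W) (count-map-∷-∷ t ((s ∷ U) ⧢w V) r W))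

  -- The shuffle product coefficientwise, summing over words U, V of
  -- lengths ≤ m, ≤ n;  (A ⧢ B) W is the case m = n = |W|.

  truncShuffle : ℕ → ℕ → PowerSeries → PowerSeries → Word k → Carrier
  truncShuffle m n A B W =
    Σ-list (wordsUpTo m) λ U → Σ-list (wordsUpTo n) λ V → (A U * B V) * count (U ⧢w V) W

  truncShuffle-ε : ∀ m n A B → truncShuffle m n A B [] ≈ A [] * B []
  truncShuffle-ε m n A B = begin
      truncShuffle m n A B []
    ≈⟨ Σ-wordsUpTo-at-ε m _ (λ s U →
         Σ-zero (wordsUpTo n) (λ V → trans (*-cong refl (count-⧢w-ε-left s U V)) (zeroʳ _))) ⟩
      Σ-list (wordsUpTo n) (λ V → (A [] * B V) * count ([] ⧢w V) [])
    ≈⟨ Σ-wordsUpTo-at-ε n _ (λ t V → trans (*-cong refl (count-⧢w-ε-right t V)) (zeroʳ _)) ⟩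
      (A [] * B []) * count ([] ⧢w []) []
    ≈⟨ trans (*-cong refl count-⧢w-ε-ε) (*-identityʳ _) ⟩
      A [] * B []
    ∎

  Σ-pull-δ : ∀ {a} {I : Set a} {p} {Q : Set p} (xs : List I) (d : Dec Q) (f g : I → Carrier) →
             Σ-list xs (λ i → f i * (δ d * g i)) ≈ δ d * Σ-list xs (λ i → f i * g i)
  Σ-pull-δ xs d f g = trans (Σ-cong xs (λ i → *-exchange (f i) (δ d) (g i))) (Σ-*ˡ xs (δ d) _)

  truncShuffle-leibniz : ∀ m n A B r W →
    truncShuffle (suc m) (suc n) A B (r ∷ W) ≈
    truncShuffle m (suc n) (ρ (r ∷ []) A) B W + truncShuffle (suc m) n A (ρ (r ∷ []) B) W
  truncShuffle-leibniz m n A B r W = begin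
      truncShuffle (suc m) (suc n) A B (r ∷ W)
    ≈⟨ Σ-cong Us (λ U → Σ-cong Vs (λ V →
         trans (*-cong refl (count-⧢w-∷ U V r W)) (distribˡ _ _ _))) ⟩
      Σ-list Us (λ U → Σ-list Vs (λ V → left U V + right U V))
    ≈⟨ trans (Σ-cong Us (λ U → Σ-+ Vs (left U) (right U))) (Σ-+ Us _ _) ⟩
      Σ-list Us (λ U → Σ-list Vs (left U)) + Σ-list Us (λ U → Σ-list Vs (right U))
    ≈⟨ +-cong left-sum (trans (Σ-swap Us Vs right) (trans right-sum (Σ-swap Vs' Us _))) ⟩
      truncShuffle m (suc n) (ρ (r ∷ []) A) B W + truncShuffle (suc m) n A (ρ (r ∷ []) B) W
    ∎
    where
    Us Vs Vs' : List (Word k)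
    Us  = wordsUpTo (suc m)
    Vs  = wordsUpTo (suc n)
    Vs' = wordsUpTo n
    left right : Word k → Word k → Carrier
    left  U V = (A U * B V) * fromLeft r U V W
    right U V = (A U * B V) * fromRight r U V W
    left-sum : Σ-list Us (λ U → Σ-list Vs (left U)) ≈ truncShuffle m (suc n) (ρ (r ∷ []) A) B W
    left-sum = Σ-wordsUpTo-first-letter m r _
      (λ s U → Σ-list Vs (λ V → (A (s ∷ U) * B V) * count (U ⧢w V) W))
      (Σ-zero Vs (λ V → zeroʳ _))
      (λ s U → Σ-pull-δ Vs (s ≟F r) (λ V → A (s ∷ U) * B V) (λ V → count (U ⧢w V) W))
    right-sum : Σ-list Vs (λ V → Σ-list Us (λ U → right U V)) ≈
                Σ-list Vs' (λ V → Σ-list Us (λ U → (A U * B (r ∷ V)) * count (U ⧢w V) W))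
    right-sum = Σ-wordsUpTo-first-letter n r _
      (λ t V → Σ-list Us (λ U → (A U * B (t ∷ V)) * count (U ⧢w V) W))
      (Σ-zero Us (λ U → zeroʳ _))
      (λ t V → Σ-pull-δ Us (t ≟F r) (λ U → A U * B (t ∷ V)) (λ U → count (U ⧢w V) W))

  -- The coefficients of A ⧢ B determined by the Leibniz rule, by recursion on W.
  shuffleRec : PowerSeries → PowerSeries → Word k → Carrier
  shuffleRec A B []      = A [] * B []
  shuffleRec A B (r ∷ W) = shuffleRec (ρ (r ∷ []) A) B W + shuffleRec A (ρ (r ∷ []) B) W

  -- once the bounds reach |W|, the truncated sum obeys the same recursion,
  -- so it no longer depends on them
  truncShuffle≈shuffleRec : ∀ W m n → length W ≤ m → length W ≤ n →
                            ∀ A B → truncShuffle m n A B W ≈ shuffleRec A B W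
  truncShuffle≈shuffleRec []      m       n       _       _       A B = truncShuffle-ε m n A B
  truncShuffle≈shuffleRec (r ∷ W) (suc m) (suc n) (s≤s p) (s≤s q) A B =
    trans (truncShuffle-leibniz m n A B r W)
          (+-cong (truncShuffle≈shuffleRec W m (suc n) p (m≤n⇒m≤1+n q) _ B)
                  (truncShuffle≈shuffleRec W (suc m) n (m≤n⇒m≤1+n p) q A _))

  shuffle≈shuffleRec : ∀ A B W → (A ⧢ B) W ≈ shuffleRec A B W
  shuffle≈shuffleRec A B W = truncShuffle≈shuffleRec W (length W) (length W) ≤-refl ≤-refl A B

  splittings : Word k → List (Word k × Word k)
  splittings []      = ([] , []) ∷ []
  splittings (s ∷ T) = map (map₁ (s ∷_)) (splittings T) ++ map (map₂ (s ∷_)) (splittings T)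

  splitTerm : PowerSeries → PowerSeries → Word k → Word k × Word k → Carrier
  splitTerm A B X (T₁ , T₂) = shuffleRec (ρ T₁ A) (ρ T₂ B) X

  shuffleRec-split : ∀ T A B X →
    shuffleRec A B (T ++ X) ≈ Σ-list (splittings T) (splitTerm A B X)
  shuffleRec-split []      A B X = sym (+-identityʳ _)
  shuffleRec-split (s ∷ T) A B X = begin
      shuffleRec (ρ (s ∷ []) A) B (T ++ X) + shuffleRec A (ρ (s ∷ []) B) (T ++ X)
    ≈⟨ +-cong (shuffleRec-split T _ B X) (shuffleRec-split T A _ X) ⟩
      Σ-list (splittings T) (splitTerm (ρ (s ∷ []) A) B X)
        + Σ-list (splittings T) (splitTerm A (ρ (s ∷ []) B) X)
    ≈⟨ +-cong (Σ-cong (splittings T) (λ { (T₁ , T₂) → refl }))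
              (Σ-cong (splittings T) (λ { (T₁ , T₂) → refl })) ⟩
      Σ-list (splittings T) (splitTerm A B X ∘ map₁ (s ∷_))
        + Σ-list (splittings T) (splitTerm A B X ∘ map₂ (s ∷_))
    ≈⟨ sym (+-cong (reflexive (Σ-map (map₁ (s ∷_)) (splittings T) _))
                   (reflexive (Σ-map (map₂ (s ∷_)) (splittings T) _))) ⟩
      Σ-list (map (map₁ (s ∷_)) (splittings T)) (splitTerm A B X)
        + Σ-list (map (map₂ (s ∷_)) (splittings T)) (splitTerm A B X)
    ≈⟨ sym (Σ-++ (map (map₁ (s ∷_)) (splittings T)) _ _) ⟩
      Σ-list (splittings (s ∷ T)) (splitTerm A B X)
    ∎

  ρ-shuffle-split : ∀ T A B X →
    ρ T (A ⧢ B) X ≈ Σ-list (splittings T) (λ p → (ρ (proj₁ p) A ⧢ ρ (proj₂ p) B) X)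
  ρ-shuffle-split T A B X =
    trans (shuffle≈shuffleRec A B (T ++ X))
          (trans (shuffleRec-split T A B X)
                 (Σ-cong (splittings T) (λ { (T₁ , T₂) → sym (shuffle≈shuffleRec _ _ X) })))

  linComb : ∀ {a} {I : Set a} → (I → PowerSeries) → List (Carrier × I) → PowerSeries
  linComb f cs X = Σ-list cs (λ { (α , i) → α * f i X })

  span-intro : ∀ {a} {I : Set a} (f : I → PowerSeries) {C} cs →
               C ≈ₛ linComb f cs → InSpan f C
  span-intro f cs C≈ = cs , λ X → trans (C≈ X) (Σ-cong cs (λ { (α , i) → refl }))

  span-elim : ∀ {a} {I : Set a} (f : I → PowerSeries) {C} →
              (C∈ : InSpan f C) → C ≈ₛ linComb f (proj₁ C∈)
  span-elim f (cs , C≈) X = trans (C≈ X) (Σ-cong cs (λ { (α , i) → refl }))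

  generator-in-span : ∀ {a} {I : Set a} (f : I → PowerSeries) i → InSpan f (f i)
  generator-in-span f i = span-intro f ((1# , i) ∷ [])
    (λ X → sym (trans (+-identityʳ _) (*-identityˡ _)))

  sum-in-span : ∀ {a b} {I : Set a} {J : Set b} (g : I → PowerSeries) (h : J → I) (js : List J) {C} →
                C ≈ₛ (λ X → Σ-list js (λ j → g (h j) X)) → InSpan g C
  sum-in-span g h js {C} C≈ = span-intro g (map (λ j → (1# , h j)) js) λ X → begin
      C X                                                ≈⟨ C≈ X ⟩
      Σ-list js (λ j → g (h j) X)                        ≈⟨ Σ-cong js (λ j → sym (*-identityˡ _)) ⟩
      Σ-list js (λ j → 1# * g (h j) X)                   ≡⟨ P.sym (Σ-map _ js _) ⟩
      linComb g (map (λ j → (1# , h j)) js) X            ∎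

  span-trans : ∀ {a b} {I : Set a} {J : Set b} (f : I → PowerSeries) (g : J → PowerSeries) {C} →
               InSpan f C → (∀ i → InSpan g (f i)) → InSpan g C
  span-trans {I = I} {J} f g C∈ f∈ =
    span-intro g (refine (proj₁ C∈)) λ X → trans (span-elim f C∈ X) (sym (refine-sum (proj₁ C∈) X))
    where
    scale : Carrier → List (Carrier × J) → List (Carrier × J)
    scale α = map (map₁ (α *_))

    scale-sum : ∀ α ds X → linComb g (scale α ds) X ≈ α * linComb g ds X
    scale-sum α []             X = sym (zeroʳ α)
    scale-sum α ((β , j) ∷ ds) X =
      trans (+-cong (*-assoc α β (g j X)) (scale-sum α ds X)) (sym (distribˡ α _ _))

    refine : List (Carrier × I) → List (Carrier × J)
    refine []             = []
    refine ((α , i) ∷ cs) = scale α (proj₁ (f∈ i)) ++ refine cs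

    refine-sum : ∀ cs X → linComb g (refine cs) X ≈ linComb f cs X
    refine-sum []             X = refl
    refine-sum ((α , i) ∷ cs) X =
      trans (Σ-++ (scale α (proj₁ (f∈ i))) (refine cs) _)
            (+-cong (trans (scale-sum α (proj₁ (f∈ i)) X) (*-cong refl (sym (span-elim g (f∈ i) X))))
                    (refine-sum cs X))

  ρ-shuffle-in-shuffleSpace : ∀ A B T → InShuffleSpace (InClosure A) (InClosure B) (ρ T (A ⧢ B))
  ρ-shuffle-in-shuffleSpace A B T =
    sum-in-span (λ { ((a , b) , _) → a ⧢ b })
                (λ p → (ρ (proj₁ p) A , ρ (proj₂ p) B)
                     , generator-in-span (λ T → ρ T A) (proj₁ p)
                     , generator-in-span (λ T → ρ T B) (proj₂ p))
                (splittings T) (ρ-shuffle-split T A B)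

proposition9p3 : ∀ {c ℓ : Level} (K : Field c ℓ) (k : ℕ)
    → let open Series K k in
    ∀ (A B C : PowerSeries)
    → InClosure (A ⧢ B) C
    → InShuffleSpace (InClosure A) (InClosure B) C
proposition9p3 K k A B C C∈closure =
  span-trans (λ T → ρ T (A ⧢ B)) (λ { ((a , b) , _) → a ⧢ b })
             C∈closure (ρ-shuffle-in-shuffleSpace A B)
  where
  open Series K k
  open ShuffleClosure K k
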